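{- If a set $S$ of complex clauses and $\epsilon$-blocks is unsatisfiable, then $S\blacktriangleright^*\mathcal{T}$ for some closed tableau $\mathcal{T}$.
   Context: Basic setting. Fix a finite signature $\Sigma$ with at least one constant, and let $r$ be its maximal arity. Variables are $x_1,x_2,\dots$, and $X_r=\{x_1,\dots,x_r\}$. All predicates are unary. Clauses are finite sets of literals, and satisfiability means having a Herbrand model. A literal or clause is trivial if it contains no function symbols. $C_1\sqcup\dots\sqcup C_n$ denotes a union of clauses with pairwise disjoint variables where $C_i\neq\emptyset$ for $i\ge2$. Clause kinds. - A complex clause is a clause $\bigvee_{i=1}^k\pm_iP_i(f_i(x^i_1,\dots,x^i_{n_i}))\lor\bigvee_{j=1}^l\pm_jQ_j(x_j)$ with $k\ge1$ and, for each $i$, $\{x^i_1,\dots,x^i_{n_i}\}$ equal to the set of all variables of the clause. - An $\epsilon$-block is a clause with at most one variable and only trivial literals (including the empty clause $\Box$). - An $\epsilon$-clause is $B_1[y_1]\sqcup\dots\sqcup B_k[y_k]$ with the $B_i$ $\epsilon$-blocks, where $B[y]$ is $B$ with its variable renamed to $y$. - Up to renaming, complex clauses use variables from $X_r$ and $\epsilon$-blocks the variable $x_{r+1}$. Instances and entailment. - For a clause $C$ and set of terms $N$, $C[N]$ is the set of instances of $C$ substituting terms of $N$ for its variables. - $\pi(C)=C[X_r]$ and $\mathsf{U}=\{f(y_1,\dots,y_n)\mid f\in\Sigma,y_i\in X_r\}$. - For a clause set $S$, $\mathsf{I}(S)=\pi(\mathsf{comp}(S))\cup\mathsf{eps}(S)[x_{r+1}]\cup\mathsf{eps}(S)[\mathsf{U}]$,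 where $\mathsf{comp}(S)$ and $\mathsf{eps}(S)$ are the complex clauses and the $\epsilon$-blocks of $S$. - $\vDash_{\mathrm{p}}$ is propositional entailment, treating every atom (ground or not) as a propositional variable. Tableaux. A tableau is $S_1\mid\dots\mid S_n$ of clause sets; it is closed if every branch contains $\Box$. Abstract step $\blacktriangleright$. $\mathcal{T}\mid S\blacktriangleright\mathcal{T}\mid S\cup\{B_1\}\mid\dots\mid S\cup\{B_k\}$ whenever $\mathsf{I}(S)\vDash_{\mathrm{p}}B_1[x_{i_1}]\sqcup\dots\sqcup B_k[x_{i_k}]$, this being an $\epsilon$-clause, with $1\le i_1,\dots,i_k\le r+1$. -}

module Defs where

open import Data.Nat using (ℕ; zero; suc; _≤_; _⊔_)
open import Data.Fin using (Fin; toℕ)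
open import Data.Bool using (Bool)
open import Data.Empty using (⊥)
open import Data.Product using (Σ; _×_; proj₁)
open import Data.Sum using (_⊎_)
open import Data.List using (List; []; _∷_; _++_; map; concat; concatMap; foldr; allFin)
open import Data.Vec using (Vec; []; _∷_)
import Data.Vec as Vec
open import Data.List.Membership.Propositional using (_∈_)
import Data.Vec.Membership.Propositional as VecMem
open import Data.List.Relation.Unary.All using (All)
open import Data.List.Relation.Unary.Any using (Any)
open import Data.List.Relation.Unary.AllPairs using (AllPairs)
open import Relation.Binary.PropositionalEquality using (_≡_; _≢_)
open import Relation.Binary.Construct.Closure.ReflexiveTransitive using (Star)
open import Function using (_∘_)

record Signature : Set where
  field
    nf       : ℕ
    arity    : Fin nf → ℕ
    np       : ℕ
    constant : Σ (Fin nf) (λ f → arity f ≡ 0)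

module _ (Sig : Signature) where
  open Signature Sig

  r : ℕ
  r = foldr (λ f m → arity f ⊔ m) 0 (allFin nf)

  -- terms over variables V (variables x_i are represented by i : ℕ)
  data Tm (V : Set) : Set where
    var : V → Tm V
    fun : (f : Fin nf) → Vec (Tm V) (arity f) → Tm V

  mutual
    subst : ∀ {V W : Set} → (V → Tm W) → Tm V → Tm W
    subst σ (var x)    = σ x
    subst σ (fun f ts) = fun f (substs σ ts)

    substs : ∀ {V W : Set} {n} → (V → Tm W) → Vec (Tm V) n → Vec (Tm W) n
    substs σ []       = []
    substs σ (t ∷ ts) = subst σ t ∷ substs σ ts

  mutual
    vars : ∀ {V : Set} → Tm V → List V
    vars (var x)    = x ∷ []
    vars (fun f ts) = varss ts

    varss : ∀ {V : Set} {n} → Vec (Tm V) n → List V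
    varss []       = []
    varss (t ∷ ts) = vars t ++ varss ts

  -- literal ±P(t)  (sign true = positive)
  record Lit : Set where
    constructor lit
    field
      sign : Bool
      pred : Fin np
      term : Tm ℕ
  open Lit public

  Clause : Set
  Clause = List Lit

  substC : (ℕ → Tm ℕ) → Clause → Clause
  substC σ = map (λ l → lit (sign l) (pred l) (subst σ (term l)))

  varsC : Clause → List ℕ
  varsC = concatMap (vars ∘ term)

  GTm : Set
  GTm = Tm ⊥

  HModel : Set
  HModel = Fin np → GTm → Bool

  HSatClause : HModel → Clause → Set
  HSatClause M C = (σ : ℕ → GTm) →
    Any (λ l → M (pred l) (subst σ (term l)) ≡ sign l) C

  Satisfiable : List Clause → Set
  Satisfiable S = Σ HModel (λ M → ∀ C → C ∈ S → HSatClause M C)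

  VarLit : Lit → Set
  VarLit l = Σ ℕ (λ x → term l ≡ var x)

  FunLitOf : Clause → Lit → Set
  FunLitOf C l = Σ (Fin nf) (λ f → Σ (Vec ℕ (arity f)) (λ xs →
    (term l ≡ fun f (Vec.map var xs)) ×
    (∀ y → (VecMem._∈_ y xs → y ∈ varsC C) × (y ∈ varsC C → VecMem._∈_ y xs))))

  IsComplex : Clause → Set
  IsComplex C = Any (FunLitOf C) C × All (λ l → FunLitOf C l ⊎ VarLit l) C

  IsEpsBlock : Clause → Set
  IsEpsBlock C = All VarLit C × (∀ y z → y ∈ varsC C → z ∈ varsC C → y ≡ z)

  xv : Fin r → ℕ
  xv i = suc (toℕ i)

  IntoX : (ℕ → Tm ℕ) → Clause → Set
  IntoX ρ C = ∀ y → y ∈ varsC C → Σ (Fin r) (λ i → ρ y ≡ var (xv i))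

  -- propositional valuation: every (possibly non-ground) atom is a variable
  PVal : Set
  PVal = Fin np → Tm ℕ → Bool

  _⊨_ : PVal → Clause → Set
  v ⊨ C = Any (λ l → v (pred l) (term l) ≡ sign l) C

  -- v satisfies I(S) = π(comp S) ∪ eps(S)[x_{r+1}] ∪ eps(S)[U]
  SatI : PVal → List Clause → Set
  SatI v S = ∀ C → C ∈ S →
    (IsComplex C → ∀ ρ → IntoX ρ C → v ⊨ substC ρ C) ×
    (IsEpsBlock C →
      (v ⊨ substC (λ _ → var (suc r)) C) ×
      (∀ f (ys : Vec (Fin r) (arity f)) →
        v ⊨ substC (λ _ → fun f (Vec.map (var ∘ xv) ys)) C))

  _⊨ₚ_ : List Clause → Clause → Set
  S ⊨ₚ D = ∀ v → SatI v S → v ⊨ D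

  Tableau : Set
  Tableau = List (List Clause)

  Closed : Tableau → Set
  Closed T = All (λ S → [] ∈ S) T

  rename : Clause × ℕ → Clause
  rename (B Data.Product., i) = substC (λ _ → var i) B

  EpsComponent : Clause × ℕ → Set
  EpsComponent (B Data.Product., i) =
    IsEpsBlock B × (∀ y → y ∈ varsC B → y ≡ suc r) × (1 ≤ i) × (i ≤ suc r)

  VarDisjoint : Clause → Clause → Set
  VarDisjoint C D = ∀ y → y ∈ varsC C → y ∈ varsC D → ⊥

  data _▶_ : Tableau → Tableau → Set where
    expand : ∀ (T₁ T₂ : Tableau) (S : List Clause)
               (b : Clause × ℕ) (bs : List (Clause × ℕ)) →
             All EpsComponent (b ∷ bs) →
             All (λ p → proj₁ p ≢ []) bs →
             AllPairs VarDisjoint (map rename (b ∷ bs)) →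
             S ⊨ₚ concat (map rename (b ∷ bs)) →
             (T₁ ++ S ∷ T₂) ▶ (T₁ ++ map (λ p → proj₁ p ∷ S) (b ∷ bs) ++ T₂)

  _▶*_ : Tableau → Tableau → Set
  _▶*_ = Star _▶_

module Submission where

-- Let A be the types (truth vectors over the predicates) not yet excluded on a
-- branch L by an ε-block excluded τ = ⋁ₚ ¬τₚ(x). If I(L) ⊨ₚ □ the branch closes.
-- If I(L) ⊨ₚ ⋁ᵢ excluded(αᵢ)[xᵢ] for some α ∈ Aʳ, expand by these blocks: each
-- new branch excludes one more type, so this terminates. Otherwise every α ∈ Aʳ
-- is realized by a propositional model of I(L) on x₁ … x_r, and these models
-- glue, along a canonical choice of α for each tuple of argument types, into a
-- Herbrand model of L.

open import Data.Bool using (Bool; true; false; not)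
import Data.Bool as Bool
import Data.Bool.Properties as BoolP
open import Data.Empty using (⊥-elim)
open import Data.Fin using (Fin; zero; suc; toℕ; fromℕ<)
import Data.Fin.Properties as FinP
open import Data.List
  using ( List; []; _∷_; _++_; map; concat; concatMap; foldr; filter; deduplicate; allFin; tabulate
        ; length; cartesianProductWith)
import Data.List.Properties as ListP
open import Data.List.Membership.Propositional using (_∈_; _∉_; find; lose)
open import Data.List.Membership.Propositional.Properties
  using ( ∈-map⁺; ∈-map⁻; ∈-++⁺ˡ; ∈-++⁺ʳ; ∈-++⁻; ∈-∃++; ∈-concatMap⁺; ∈-concatMap⁻; ∈-allFin
        ; ∈-filter⁺; ∈-filter⁻; ∈-deduplicate⁺; ∈-deduplicate⁻
        ; ∈-cartesianProductWith⁺; ∈-cartesianProductWith⁻)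
open import Data.List.Relation.Binary.Subset.Propositional using (_⊆_)
import Data.List.Relation.Binary.Subset.Propositional.Properties as SubsetP
open import Data.List.Relation.Unary.All using (All; []; _∷_)
import Data.List.Relation.Unary.All as All
import Data.List.Relation.Unary.All.Properties as AllP
open import Data.List.Relation.Unary.AllPairs using (AllPairs; []; _∷_)
import Data.List.Relation.Unary.AllPairs.Properties as AllPairsP
open import Data.List.Relation.Unary.Any using (Any; here; there)
import Data.List.Relation.Unary.Any as Any
import Data.List.Relation.Unary.Any.Properties as AnyP
open import Data.List.Relation.Unary.Unique.Propositional using (Unique)
open import Data.List.Relation.Unary.Unique.DecPropositional.Properties using (deduplicate-!)
open import Data.Nat using (ℕ; zero; suc; _≤_; _<_; _⊔_; z≤n; s≤s)
import Data.Nat.Properties as ℕP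
open ℕP using (≤-trans; ≤-reflexive)
open import Data.Product using (Σ; ∃; ∃₂; _×_; _,_; proj₁; proj₂; map₂; curry; uncurry)
import Data.Product.Properties as ProdP
open import Data.Sum using (_⊎_; inj₁; inj₂; [_,_]′)
open import Data.Vec using (Vec; []; _∷_; toList)
import Data.Vec as Vec
import Data.Vec.Properties as VecP
import Data.Vec.Membership.Propositional as VecMem
open import Data.Vec.Membership.Propositional.Properties using (∈-toList⁺; ∈-toList⁻)
open import Function using (_∘_; const; id)
open import Relation.Binary.Construct.Closure.ReflexiveTransitive using (ε; _◅_; _◅◅_)
import Relation.Binary.Construct.Closure.ReflexiveTransitive as Star
open import Relation.Binary.Definitions using (DecidableEquality)
open import Relation.Binary.PropositionalEquality using (_≡_; _≢_; refl; sym; trans; cong; cong₂)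
import Relation.Binary.PropositionalEquality as ≡
open import Relation.Nullary using (¬_; Dec; yes; no; ¬?; _×-dec_)

import Defs as D

vectors : ∀ {A : Set} → List A → (n : ℕ) → List (Vec A n)
vectors xs zero    = [] ∷ []
vectors xs (suc n) = cartesianProductWith _∷_ xs (vectors xs n)

∈-vectors⁺ : ∀ {A : Set} {xs : List A} {n} (v : Vec A n) →
             (∀ i → Vec.lookup v i ∈ xs) → v ∈ vectors xs n
∈-vectors⁺ []      _  = here refl
∈-vectors⁺ (x ∷ v) v∈ = ∈-cartesianProductWith⁺ _∷_ (v∈ zero) (∈-vectors⁺ v (v∈ ∘ suc))

∈-vectors⁻ : ∀ {A : Set} (xs : List A) {n} {v : Vec A n} →
             v ∈ vectors xs n → ∀ i → Vec.lookup v i ∈ xs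
∈-vectors⁻ xs {suc n} v∈ i with ∈-cartesianProductWith⁻ _∷_ xs (vectors xs n) v∈
∈-vectors⁻ xs v∈ zero    | _ , _ , x∈ , _  , refl = x∈
∈-vectors⁻ xs v∈ (suc i) | _ , _ , _  , w∈ , refl = ∈-vectors⁻ xs w∈ i

module _ {A B : Set} (_≟_ : DecidableEquality A) where

  update : A → B → (A → B) → A → B
  update a b g x with x ≟ a
  ... | yes _ = b
  ... | no _  = g x

  functions : B → List B → List A → List (A → B)
  functions default bs []       = const default ∷ []
  functions default bs (a ∷ as) = cartesianProductWith (update a) bs (functions default bs as)

  functions-complete : ∀ {default bs} as (g : A → B) → (∀ a → a ∈ as → g a ∈ bs) →
    ∃ λ h → h ∈ functions default bs as × ∀ a → a ∈ as → h a ≡ g a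
  functions-complete []       g g∈ = _ , here refl , λ _ ()
  functions-complete (a ∷ as) g g∈ with functions-complete as g (λ x → g∈ x ∘ there)
  ... | h , h∈ , h≗g =
    update a (g a) h , ∈-cartesianProductWith⁺ (update a) (g∈ a (here refl)) h∈ , agree
    where
    agree : ∀ x → x ∈ a ∷ as → update a (g a) h x ≡ g x
    agree x x∈ with x ≟ a
    agree x x∈          | yes refl = refl
    agree x (here refl) | no x≢a   = ⊥-elim (x≢a refl)
    agree x (there x∈)  | no _     = h≗g x x∈

  functions-sound : ∀ {default bs h} as → h ∈ functions default bs as → ∀ a → a ∈ as → h a ∈ bs
  functions-sound {default} {bs} (a ∷ as) h∈ x x∈
    with ∈-cartesianProductWith⁻ (update a) bs (functions default bs as) h∈
  ... | b , h₀ , b∈ , h₀∈ , refl with x ≟ a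
  ...   | yes _ = b∈
  ...   | no x≢a with x∈
  ...     | here refl = ⊥-elim (x≢a refl)
  ...     | there x∈as = functions-sound as h₀∈ x x∈as

Unique-⊆⇒length≤ : ∀ {A : Set} {xs ys : List A} → Unique xs → xs ⊆ ys → length xs ≤ length ys
Unique-⊆⇒length≤ {xs = []}     _             _   = z≤n
Unique-⊆⇒length≤ {xs = x ∷ xs} (x∉xs ∷ uniq) sub with ∈-∃++ (sub (here refl))
... | ys₁ , ys₂ , refl =
  ≤-trans (s≤s (Unique-⊆⇒length≤ uniq sub′)) (≤-reflexive (sym (ListP.length-++-sucʳ ys₁ x ys₂)))
  where
  sub′ : xs ⊆ ys₁ ++ ys₂
  sub′ {z} z∈xs with ∈-++⁻ ys₁ (sub (there z∈xs))
  ... | inj₁ z∈ys₁        = ∈-++⁺ˡ z∈ys₁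
  ... | inj₂ (here refl)  = ⊥-elim (All.lookup x∉xs z∈xs refl)
  ... | inj₂ (there z∈ys₂) = ∈-++⁺ʳ ys₁ z∈ys₂

-- Scanning a fixed enumeration makes canon xs depend only on the set of elements of xs.
module Canonical
  {A : Set} (_≟_ : DecidableEquality A) (enum : List A) (∈-enum : ∀ x → x ∈ enum) where
  open import Data.List.Membership.DecPropositional _≟_ using (_∈?_)

  canon : List A → List A
  canon xs = deduplicate _≟_ (filter (_∈? xs) enum)

  ∈-canon⁺ : ∀ {x xs} → x ∈ xs → x ∈ canon xs
  ∈-canon⁺ {xs = xs} x∈ = ∈-deduplicate⁺ _≟_ (∈-filter⁺ (_∈? xs) (∈-enum _) x∈)

  ∈-canon⁻ : ∀ {x} xs → x ∈ canon xs → x ∈ xs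
  ∈-canon⁻ xs x∈ = proj₂ (∈-filter⁻ (_∈? xs) {xs = enum} (∈-deduplicate⁻ _≟_ _ x∈))

  canon-cong : ∀ {xs ys} → xs ⊆ ys → ys ⊆ xs → canon xs ≡ canon ys
  canon-cong {xs} {ys} xs⊆ys ys⊆xs =
    cong (deduplicate _≟_) (ListP.filter-≐ (_∈? xs) (_∈? ys) (xs⊆ys , ys⊆xs) enum)

  length-canon : ∀ {xs ys} → xs ⊆ ys → length (canon xs) ≤ length ys
  length-canon {xs} xs⊆ys = Unique-⊆⇒length≤ (deduplicate-! _≟_ _) (xs⊆ys ∘ ∈-canon⁻ xs)

module _ {A : Set} (_≟_ : DecidableEquality A) where

  position : List A → A → ℕ
  position []       x = 0
  position (y ∷ ys) x with x ≟ y
  ... | yes _ = 0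
  ... | no _  = suc (position ys x)

  position<length : ∀ {x} ys → x ∈ ys → position ys x < length ys
  position<length {x} (y ∷ ys) x∈ with x ≟ y
  position<length (y ∷ ys) x∈          | yes _   = s≤s z≤n
  position<length (y ∷ ys) (here refl) | no x≢y  = ⊥-elim (x≢y refl)
  position<length (y ∷ ys) (there x∈)  | no _    = s≤s (position<length ys x∈)

  remove : A → List A → List A
  remove x = filter (λ y → ¬? (y ≟ x))

  length-remove< : ∀ {x xs} → x ∈ xs → length (remove x xs) < length xs
  length-remove< {x} {xs} x∈ =
    ListP.filter-notAll (λ y → ¬? (y ≟ x)) xs (Any.map (λ x≡y y≢x → y≢x (sym x≡y)) x∈)

  ∉-remove : ∀ {x y xs} → y ∉ remove x xs → y ≡ x ⊎ y ∉ xs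
  ∉-remove {x} {y} y∉ with y ≟ x
  ... | yes y≡x = inj₁ y≡x
  ... | no y≢x  = inj₂ (λ y∈ → y∉ (∈-filter⁺ (λ z → ¬? (z ≟ x)) y∈ y≢x))

nth : ∀ {A : Set} → A → List A → ℕ → A
nth d []       k       = d
nth d (y ∷ ys) zero    = y
nth d (y ∷ ys) (suc k) = nth d ys k

nth-position : ∀ {A : Set} (_≟_ : DecidableEquality A) d {x} ys → x ∈ ys →
               nth d ys (position _≟_ ys x) ≡ x
nth-position _≟_ d {x} (y ∷ ys) x∈ with x ≟ y
nth-position _≟_ d (y ∷ ys) x∈          | yes refl = refl
nth-position _≟_ d (y ∷ ys) (here refl) | no x≢y   = ⊥-elim (x≢y refl)
nth-position _≟_ d (y ∷ ys) (there x∈)  | no _     = nth-position _≟_ d ys x∈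

nth-All : ∀ {A : Set} {P : A → Set} {d} ys → P d → All P ys → ∀ k → P (nth d ys k)
nth-All []       Pd _          k       = Pd
nth-All (y ∷ ys) Pd (Py ∷ Pys) zero    = Py
nth-All (y ∷ ys) Pd (Py ∷ Pys) (suc k) = nth-All ys Pd Pys k

Any⊎All : ∀ {A : Set} {P Q : A → Set} → (∀ x → P x ⊎ Q x) → ∀ xs → Any P xs ⊎ All Q xs
Any⊎All P⊎Q []       = inj₂ []
Any⊎All P⊎Q (x ∷ xs) with P⊎Q x | Any⊎All P⊎Q xs
... | inj₁ Px | _         = inj₁ (here Px)
... | inj₂ _  | inj₁ any  = inj₁ (there any)
... | inj₂ Qx | inj₂ all  = inj₂ (Qx ∷ all)

map-factor : ∀ {A B C : Set} {n} (f : A → C) (g : B → C) (xs : Vec A n) →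
             (∀ x → x ∈ toList xs → ∃ λ y → f x ≡ g y) → ∃ λ ys → Vec.map f xs ≡ Vec.map g ys
map-factor f g []       _ = [] , refl
map-factor f g (x ∷ xs) h with h x (here refl) | map-factor f g xs (λ y → h y ∘ there)
... | y , fx≡gy | ys , eq = y ∷ ys , cong₂ _∷_ fx≡gy eq

toList-⊆⊇ : ∀ {A : Set} {n} {xs : Vec A n} {ys : List A} →
            (∀ y → (y VecMem.∈ xs → y ∈ ys) × (y ∈ ys → y VecMem.∈ xs)) →
            toList xs ⊆ ys × ys ⊆ toList xs
toList-⊆⊇ same = (λ y∈ → proj₁ (same _) (∈-toList⁻ y∈)) , (λ y∈ → ∈-toList⁺ (proj₂ (same _) y∈))

≤-foldr-⊔ : ∀ {A : Set} (g : A → ℕ) {x xs} → x ∈ xs → g x ≤ foldr (λ y m → g y ⊔ m) 0 xs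
≤-foldr-⊔ g (here refl)        = ℕP.m≤m⊔n _ _
≤-foldr-⊔ g {xs = y ∷ _} (there x∈) = ≤-trans (≤-foldr-⊔ g x∈) (ℕP.m≤n⊔m (g y) _)

module Completeness (Sig : D.Signature) where
  open D.Signature Sig
  open D using (Tm; var; fun; lit; sign; pred; term)

  Term : Set
  Term = Tm Sig ℕ

  GTerm : Set
  GTerm = D.GTm Sig

  Literal : Set
  Literal = D.Lit Sig

  Clause : Set
  Clause = D.Clause Sig

  PVal : Set
  PVal = D.PVal Sig

  r : ℕ
  r = D.r Sig

  xv : Fin r → ℕ
  xv = D.xv Sig

  subst : ∀ {V W : Set} → (V → Tm Sig W) → Tm Sig V → Tm Sig W
  subst = D.subst Sig

  substs : ∀ {V W : Set} {n} → (V → Tm Sig W) → Vec (Tm Sig V) n → Vec (Tm Sig W) n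
  substs = D.substs Sig

  vars : ∀ {V : Set} → Tm Sig V → List V
  vars = D.vars Sig

  varss : ∀ {V : Set} {n} → Vec (Tm Sig V) n → List V
  varss = D.varss Sig

  varsC : Clause → List ℕ
  varsC = D.varsC Sig

  substC : (ℕ → Term) → Clause → Clause
  substC = D.substC Sig

  substL : (ℕ → Term) → Literal → Literal
  substL σ l = lit (sign l) (pred l) (subst σ (term l))

  _⊨_ : PVal → Clause → Set
  _⊨_ = D._⊨_ Sig

  IsComplex : Clause → Set
  IsComplex = D.IsComplex Sig

  IsEpsBlock : Clause → Set
  IsEpsBlock = D.IsEpsBlock Sig

  SatI : PVal → List Clause → Set
  SatI = D.SatI Sig

  _⊨ₚ_ : List Clause → Clause → Set
  _⊨ₚ_ = D._⊨ₚ_ Sig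

  IntoX : (ℕ → Term) → Clause → Set
  IntoX = D.IntoX Sig

  rename : Clause × ℕ → Clause
  rename = D.rename Sig

  VarDisjoint : Clause → Clause → Set
  VarDisjoint = D.VarDisjoint Sig

  EpsComponent : Clause × ℕ → Set
  EpsComponent = D.EpsComponent Sig

  Tableau : Set
  Tableau = D.Tableau Sig

  _▶_ : Tableau → Tableau → Set
  _▶_ = D._▶_ Sig

  _▶*_ : Tableau → Tableau → Set
  _▶*_ = D._▶*_ Sig

  ComplexOrBlock : Clause → Set
  ComplexOrBlock C = IsComplex C ⊎ IsEpsBlock C

  module _ {V : Set} (_≟ᵥ_ : DecidableEquality V) where
    mutual
      _≟ₜ_ : DecidableEquality (Tm Sig V)
      var x ≟ₜ var y with x ≟ᵥ y
      ... | yes refl = yes refl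
      ... | no x≢y   = no λ { refl → x≢y refl }
      var _ ≟ₜ fun _ _ = no λ ()
      fun _ _ ≟ₜ var _ = no λ ()
      fun f ts ≟ₜ fun g us with f FinP.≟ g
      ... | no f≢g = no λ { refl → f≢g refl }
      ... | yes refl with ts ≟ₜₛ us
      ...   | yes refl = yes refl
      ...   | no ts≢us = no λ { refl → ts≢us refl }

      _≟ₜₛ_ : ∀ {n} → DecidableEquality (Vec (Tm Sig V) n)
      [] ≟ₜₛ [] = yes refl
      (t ∷ ts) ≟ₜₛ (u ∷ us) with t ≟ₜ u | ts ≟ₜₛ us
      ... | yes refl | yes refl = yes refl
      ... | no t≢u   | _        = no λ { refl → t≢u refl }
      ... | _        | no ts≢us = no λ { refl → ts≢us refl }

  mutual
    subst-cong : ∀ {V W : Set} {σ τ : V → Tm Sig W} (t : Tm Sig V) →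
                 (∀ y → y ∈ vars t → σ y ≡ τ y) → subst σ t ≡ subst τ t
    subst-cong (var x)    σ≗τ = σ≗τ x (here refl)
    subst-cong (fun f ts) σ≗τ = cong (fun f) (substs-cong ts σ≗τ)

    substs-cong : ∀ {V W : Set} {n} {σ τ : V → Tm Sig W} (ts : Vec (Tm Sig V) n) →
                  (∀ y → y ∈ varss ts → σ y ≡ τ y) → substs σ ts ≡ substs τ ts
    substs-cong []       _   = refl
    substs-cong (t ∷ ts) σ≗τ =
      cong₂ _∷_ (subst-cong t (λ y → σ≗τ y ∘ ∈-++⁺ˡ))
                (substs-cong ts (λ y → σ≗τ y ∘ ∈-++⁺ʳ (vars t)))

  substC-cong : ∀ {σ τ : ℕ → Term} C → (∀ y → y ∈ varsC C → σ y ≡ τ y) → substC σ C ≡ substC τ C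
  substC-cong []      _   = refl
  substC-cong (l ∷ C) σ≗τ =
    cong₂ _∷_ (cong (lit (sign l) (pred l)) (subst-cong (term l) (λ y → σ≗τ y ∘ ∈-++⁺ˡ)))
              (substC-cong C (λ y → σ≗τ y ∘ ∈-++⁺ʳ (vars (term l))))

  substs-map-var : ∀ {V W : Set} {n} (σ : V → Tm Sig W) (xs : Vec V n) →
                   substs σ (Vec.map var xs) ≡ Vec.map σ xs
  substs-map-var σ []       = refl
  substs-map-var σ (x ∷ xs) = cong (σ x ∷_) (substs-map-var σ xs)

  mutual
    ∈-vars-subst-const : ∀ {V W : Set} {k : W} (t : Tm Sig V) {y} →
                         y ∈ vars (subst (λ _ → var k) t) → y ≡ k
    ∈-vars-subst-const (var x)    (here refl) = refl
    ∈-vars-subst-const (fun f ts) y∈          = ∈-varss-substs-const ts y∈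

    ∈-varss-substs-const : ∀ {V W : Set} {k : W} {n} (ts : Vec (Tm Sig V) n) {y} →
                           y ∈ varss (substs (λ _ → var k) ts) → y ≡ k
    ∈-varss-substs-const (t ∷ ts) y∈ with ∈-++⁻ (vars (subst _ t)) y∈
    ... | inj₁ y∈t  = ∈-vars-subst-const t y∈t
    ... | inj₂ y∈ts = ∈-varss-substs-const ts y∈ts

  ∈-varsC⁺ : ∀ {C l y} → l ∈ C → y ∈ vars (term l) → y ∈ varsC C
  ∈-varsC⁺ l∈ y∈ = ∈-concatMap⁺ (vars ∘ term) (lose l∈ y∈)

  ∈-varsC⁻ : ∀ C {y} → y ∈ varsC C → ∃ λ l → l ∈ C × y ∈ vars (term l)
  ∈-varsC⁻ C y∈ = find (∈-concatMap⁻ (vars ∘ term) {xs = C} y∈)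

  var-∈-varsC : ∀ {C l y} → l ∈ C → term l ≡ var y → y ∈ varsC C
  var-∈-varsC l∈ t≡y = ∈-varsC⁺ l∈ (≡.subst (λ t → _ ∈ vars t) (sym t≡y) (here refl))

  ∈-varsC-substC-const : ∀ {k y} C → y ∈ varsC (substC (λ _ → var k) C) → y ≡ k
  ∈-varsC-substC-const {k} C y∈ with ∈-varsC⁻ (substC (λ _ → var k) C) y∈
  ... | _ , l∈ , y∈l with ∈-map⁻ (substL (λ _ → var k)) l∈
  ...   | l , _ , refl = ∈-vars-subst-const (term l) y∈l

  Atom : Set
  Atom = Fin np × Term

  atom : Literal → Atom
  atom l = pred l , term l

  _⊨?_ : ∀ v C → Dec (v ⊨ C)
  v ⊨? C = Any.any? (λ l → v (pred l) (term l) Bool.≟ sign l) C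

  ⊨-resp : ∀ {v w C} → (∀ l → l ∈ C → v (pred l) (term l) ≡ w (pred l) (term l)) → v ⊨ C → w ⊨ C
  ⊨-resp v≗w v⊨C with find v⊨C
  ... | l , l∈ , v⊨l = lose l∈ (trans (sym (v≗w l l∈)) v⊨l)

  Refutes : List Clause → Clause → PVal → Set
  Refutes D B v = All (v ⊨_) D × ¬ v ⊨ B

  refutes? : ∀ D B v → Dec (Refutes D B v)
  refutes? D B v = All.all? (v ⊨?_) D ×-dec ¬? (v ⊨? B)

  _≟ₐ_ : DecidableEquality Atom
  _≟ₐ_ = ProdP.≡-dec FinP._≟_ (_≟ₜ_ ℕP._≟_)

  atomsOf : List Clause → List Atom
  atomsOf = concatMap (map atom)

  valuationsOn : List Atom → List (Atom → Bool)
  valuationsOn = functions _≟ₐ_ false (true ∷ false ∷ [])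

  ∈-bool : ∀ b → b ∈ true ∷ false ∷ []
  ∈-bool true  = here refl
  ∈-bool false = there (here refl)

  -- Only the atoms of B and D matter, so finitely many valuations are tried.
  entailed-or-refuted : ∀ D B → (∀ v → All (v ⊨_) D → v ⊨ B) ⊎ Σ PVal (Refutes D B)
  entailed-or-refuted D B with Any.any? (refutes? D B ∘ curry) (valuationsOn (atomsOf (B ∷ D)))
  ... | yes found = inj₂ (_ , proj₂ (proj₂ (find found)))
  ... | no none   = inj₁ entailed
    where
    entailed : ∀ v → All (v ⊨_) D → v ⊨ B
    entailed v v⊨D with v ⊨? B
    ... | yes v⊨B = v⊨B
    ... | no v⊭B with functions-complete _≟ₐ_ (atomsOf (B ∷ D)) (uncurry v) (λ _ _ → ∈-bool _)
    ...   | w , w∈ , w≗v = ⊥-elim (none (lose w∈ (w⊨D , v⊭B ∘ ⊨-resp (agree (here refl)))))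
      where
      agree : ∀ {C} → C ∈ B ∷ D → ∀ l → l ∈ C → curry w (pred l) (term l) ≡ v (pred l) (term l)
      agree C∈ l l∈ = w≗v _ (∈-concatMap⁺ (map atom) (lose C∈ (∈-map⁺ atom l∈)))

      w⊨D : All (curry w ⊨_) D
      w⊨D = All.tabulate λ C∈ → ⊨-resp (λ l l∈ → sym (agree (there C∈) l l∈)) (All.lookup v⊨D C∈)

  U : (f : Fin nf) → Vec (Fin r) (arity f) → Term
  U f ys = fun f (Vec.map (var ∘ xv) ys)

  Uterms-of : Fin nf → List Term
  Uterms-of f = map (U f) (vectors (allFin r) (arity f))

  Uterms : List Term
  Uterms = concatMap Uterms-of (allFin nf)

  ∈-Uterms⁺ : ∀ f ys → U f ys ∈ Uterms
  ∈-Uterms⁺ f ys =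
    ∈-concatMap⁺ _ (lose (∈-allFin f) (∈-map⁺ (U f) (∈-vectors⁺ ys (λ _ → ∈-allFin _))))

  ∈-Uterms⁻ : ∀ {t} → t ∈ Uterms → ∃₂ λ f ys → t ≡ U f ys
  ∈-Uterms⁻ t∈ with find (∈-concatMap⁻ Uterms-of {xs = allFin nf} t∈)
  ... | f , _ , t∈Uf with ∈-map⁻ (U f) t∈Uf
  ...   | ys , _ , refl = f , ys , refl

  SatIClause : PVal → Clause → Set
  SatIClause v C =
    (IsComplex C → ∀ ρ → IntoX ρ C → v ⊨ substC ρ C) ×
    (IsEpsBlock C → (v ⊨ substC (λ _ → var (suc r)) C) × (∀ f ys → v ⊨ substC (λ _ → U f ys) C))

  complex-not-block : ∀ {C} → IsComplex C → ¬ IsEpsBlock C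
  complex-not-block (funLit , _) (allVar , _) with find funLit
  ... | l , l∈ , _ , _ , t≡fun , _ with All.lookup allVar l∈
  ...   | _ , t≡var with trans (sym t≡fun) t≡var
  ...     | ()

  renamings : Clause → List (ℕ → Term)
  renamings C = functions ℕP._≟_ (var 0) (map (var ∘ xv) (allFin r)) (varsC C)

  into-X⇒values : ∀ {C ρ} → IntoX ρ C → ∀ y → y ∈ varsC C → ρ y ∈ map (var ∘ xv) (allFin r)
  into-X⇒values ρ∈X y y∈ with ρ∈X y y∈
  ... | i , ρy≡ = ≡.subst (_∈ _) (sym ρy≡) (∈-map⁺ (var ∘ xv) (∈-allFin i))

  renaming-into-X : ∀ C {ρ} → ρ ∈ renamings C → IntoX ρ C
  renaming-into-X C ρ∈ y y∈ with ∈-map⁻ (var ∘ xv) (functions-sound ℕP._≟_ (varsC C) ρ∈ y y∈)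
  ... | i , _ , ρy≡ = i , ρy≡

  -- I({C}), with one renaming of C for each map from its variables into X_r.
  instances : ∀ C → ComplexOrBlock C → List Clause
  instances C (inj₁ _) = map (λ ρ → substC ρ C) (renamings C)
  instances C (inj₂ _) = map (λ t → substC (λ _ → t) C) (var (suc r) ∷ Uterms)

  instances-sound : ∀ {v} C k → SatIClause v C → All (v ⊨_) (instances C k)
  instances-sound C (inj₁ cx) (comp , _) =
    AllP.map⁺ (All.tabulate λ ρ∈ → comp cx _ (renaming-into-X C ρ∈))
  instances-sound {v} C (inj₂ eb) (_ , block) = proj₁ (block eb) ∷ AllP.map⁺ (All.tabulate at-U)
    where
    at-U : ∀ {t} → t ∈ Uterms → v ⊨ substC (λ _ → t) C
    at-U t∈ with ∈-Uterms⁻ t∈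
    ... | f , ys , refl = proj₂ (block eb) f ys

  instances-complete : ∀ {v} C k → All (v ⊨_) (instances C k) → SatIClause v C
  instances-complete {v} C (inj₁ cx) v⊨ = comp , ⊥-elim ∘ complex-not-block cx
    where
    comp : IsComplex C → ∀ ρ → IntoX ρ C → v ⊨ substC ρ C
    comp _ ρ ρ∈X with functions-complete ℕP._≟_ (varsC C) ρ (into-X⇒values {C} ρ∈X)
    ... | ρ′ , ρ′∈ , ρ′≗ρ =
      ≡.subst (v ⊨_) (substC-cong C ρ′≗ρ) (All.lookup (AllP.map⁻ v⊨) ρ′∈)
  instances-complete C (inj₂ eb) v⊨ =
    (λ cx → ⊥-elim (complex-not-block cx eb)) ,
    λ _ → All.head v⊨ , λ f ys → All.lookup (AllP.map⁻ (All.tail v⊨)) (∈-Uterms⁺ f ys)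

  instancesAll : ∀ L → All ComplexOrBlock L → List Clause
  instancesAll []      []       = []
  instancesAll (C ∷ L) (k ∷ ks) = instances C k ++ instancesAll L ks

  SatI⇒instances : ∀ {v} L ks → SatI v L → All (v ⊨_) (instancesAll L ks)
  SatI⇒instances []      []       _   = []
  SatI⇒instances (C ∷ L) (k ∷ ks) sat =
    AllP.++⁺ (instances-sound C k (sat C (here refl))) (SatI⇒instances L ks (λ C′ → sat C′ ∘ there))

  instances⇒SatI : ∀ {v} L ks → All (v ⊨_) (instancesAll L ks) → SatI v L
  instances⇒SatI (C ∷ L) (k ∷ ks) v⊨ _ (here refl) = instances-complete C k (AllP.++⁻ˡ _ v⊨)
  instances⇒SatI (C ∷ L) (k ∷ ks) v⊨ _ (there C′∈) = instances⇒SatI L ks (AllP.++⁻ʳ _ v⊨) _ C′∈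

  decide-⊨ₚ : ∀ L → All ComplexOrBlock L → ∀ B → L ⊨ₚ B ⊎ Σ PVal λ v → SatI v L × ¬ v ⊨ B
  decide-⊨ₚ L ks B with entailed-or-refuted (instancesAll L ks) B
  ... | inj₁ entailed         = inj₁ λ v sat → entailed v (SatI⇒instances L ks sat)
  ... | inj₂ (v , v⊨ , v⊭B) = inj₂ (v , instances⇒SatI L ks v⊨ , v⊭B)

  Type : Set
  Type = Vec Bool np

  _≟ᵀ_ : DecidableEquality Type
  _≟ᵀ_ = VecP.≡-dec Bool._≟_

  allTypes : List Type
  allTypes = vectors (true ∷ false ∷ []) np

  ∈-allTypes : ∀ τ → τ ∈ allTypes
  ∈-allTypes τ = ∈-vectors⁺ τ (λ _ → ∈-bool _)

  open import Data.List.Membership.DecPropositional _≟ᵀ_ using () renaming (_∈?_ to _∈ᵀ?_)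

  typeOf : PVal → Term → Type
  typeOf v t = Vec.tabulate (λ p → v p t)

  lookup-typeOf : ∀ v t p → Vec.lookup (typeOf v t) p ≡ v p t
  lookup-typeOf v t = VecP.lookup∘tabulate (λ p → v p t)

  excludedLit : Type → Fin np → Literal
  excludedLit τ p = lit (not (Vec.lookup τ p)) p (var (suc r))

  -- The ε-block saying that x_{r+1} does not have type τ.
  excluded : Type → Clause
  excluded τ = map (excludedLit τ) (allFin np)

  varsC-excluded : ∀ τ {y} → y ∈ varsC (excluded τ) → y ≡ suc r
  varsC-excluded τ y∈ with ∈-varsC⁻ (excluded τ) y∈
  ... | l , l∈ , y∈l with ∈-map⁻ (excludedLit τ) l∈
  ...   | p , _ , refl with y∈l
  ...     | here refl = refl

  excluded-block : ∀ τ → IsEpsBlock (excluded τ)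
  excluded-block τ =
    AllP.map⁺ (All.tabulate (λ _ → suc r , refl)) ,
    λ y z y∈ z∈ → trans (varsC-excluded τ y∈) (sym (varsC-excluded τ z∈))

  excluded-nonempty : ∀ τ → Fin np → excluded τ ≢ []
  excluded-nonempty τ p eq with ≡.subst (excludedLit τ p ∈_) eq (∈-map⁺ (excludedLit τ) (∈-allFin p))
  ... | ()

  ⊨-excluded⇒≢ : ∀ {v t} τ → v ⊨ substC (λ _ → t) (excluded τ) → typeOf v t ≢ τ
  ⊨-excluded⇒≢ {v} {t} _ sat refl with Any.satisfied (AnyP.map⁻ (AnyP.map⁻ sat))
  ... | p , vpt≡ = BoolP.not-¬ refl (trans vpt≡ (cong not (lookup-typeOf v t p)))

  ⊭-excluded⇒≡ : ∀ {v t} τ → ¬ v ⊨ substC (λ _ → t) (excluded τ) → typeOf v t ≡ τ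
  ⊭-excluded⇒≡ {v} {t} τ v⊭ = trans (VecP.tabulate-cong pointwise) (VecP.tabulate∘lookup τ)
    where
    pointwise : ∀ p → v p t ≡ Vec.lookup τ p
    pointwise p with v p t Bool.≟ Vec.lookup τ p
    ... | yes vpt≡ = vpt≡
    ... | no vpt≢  =
      ⊥-elim (v⊭ (AnyP.map⁺ (AnyP.map⁺ {xs = allFin np} (lose (∈-allFin p) (BoolP.¬-not vpt≢)))))

  typeOf∈ : ∀ {v t} A → (∀ τ → τ ∉ A → v ⊨ substC (λ _ → t) (excluded τ)) → typeOf v t ∈ A
  typeOf∈ {v} {t} A excludes with typeOf v t ∈ᵀ? A
  ... | yes τ∈ = τ∈
  ... | no τ∉  = ⊥-elim (⊨-excluded⇒≢ _ (excludes _ τ∉) refl)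

  typeOf-xᵣ₊₁∈ : ∀ {v A L} → (∀ τ → τ ∉ A → excluded τ ∈ L) → SatI v L → typeOf v (var (suc r)) ∈ A
  typeOf-xᵣ₊₁∈ excl sat = typeOf∈ _ λ τ τ∉ → proj₁ (proj₂ (sat _ (excl τ τ∉)) (excluded-block τ))

  typeOf-U∈ : ∀ {v A L} → (∀ τ → τ ∉ A → excluded τ ∈ L) → SatI v L → ∀ f ys → typeOf v (U f ys) ∈ A
  typeOf-U∈ excl sat f ys =
    typeOf∈ _ λ τ τ∉ → proj₂ (proj₂ (sat _ (excl τ τ∉)) (excluded-block τ)) f ys

  -- The components of the ε-clause excluded(α₁)[x₁] ⊔ … ⊔ excluded(α_r)[x_r].
  blocks : Vec Type r → List (Clause × ℕ)
  blocks α = tabulate (λ i → excluded (Vec.lookup α i) , xv i)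

  Realizes : Vec Type r → PVal → Set
  Realizes α v = ∀ i → typeOf v (var (xv i)) ≡ Vec.lookup α i

  ⊭blocks⇒Realizes : ∀ {v} α → ¬ v ⊨ concat (map rename (blocks α)) → Realizes α v
  ⊭blocks⇒Realizes {v} α v⊭ i =
    ⊭-excluded⇒≡ _ (v⊭ ∘ AnyP.concat⁺ ∘ AnyP.map⁺ ∘ AnyP.tabulate⁺ {P = λ b → v ⊨ rename b} i)

  blocks-components : ∀ α → All EpsComponent (blocks α)
  blocks-components α = AllP.tabulate⁺ λ i →
    excluded-block (Vec.lookup α i) , (λ _ → varsC-excluded (Vec.lookup α i)) ,
    s≤s z≤n , s≤s (FinP.toℕ≤n i)

  blocks-nonempty : ∀ α → Fin np → All (λ b → proj₁ b ≢ []) (blocks α)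
  blocks-nonempty α p = AllP.tabulate⁺ λ i → excluded-nonempty (Vec.lookup α i) p

  blocks-disjoint : ∀ α → AllPairs VarDisjoint (map rename (blocks α))
  blocks-disjoint α =
    ≡.subst (AllPairs VarDisjoint) (sym (ListP.map-tabulate _ rename)) (AllPairsP.tabulate⁺ disjoint)
    where
    disjoint : ∀ {i j : Fin r} → i ≢ j →
      VarDisjoint (rename (excluded (Vec.lookup α i) , xv i)) (rename (excluded (Vec.lookup α j) , xv j))
    disjoint {i} {j} i≢j y y∈i y∈j = i≢j (FinP.toℕ-injective (ℕP.suc-injective
      (trans (sym (∈-varsC-substC-const (excluded (Vec.lookup α i)) y∈i))
             (∈-varsC-substC-const (excluded (Vec.lookup α j)) y∈j))))

  ⊨-concat⇒≢[] : ∀ {v} bs → v ⊨ concat (map rename bs) → bs ≢ []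
  ⊨-concat⇒≢[] (_ ∷ _) _ ()

  arity≤r : ∀ f → arity f ≤ r
  arity≤r f = ≤-foldr-⊔ arity (∈-allFin f)

  -- Given valuations realizing every tuple of types from A for x_1 … x_r, a Herbrand
  -- model is obtained by giving f(t₁,…,tₙ) the type of the U-term f(x_{k₁},…,x_{kₙ})
  -- in the valuation realizing the canonical listing of the types of the tᵢ.
  module HerbrandModel
    (L : List Clause) (A : List Type) (excl : ∀ τ → τ ∉ A → excluded τ ∈ L)
    (τ₀ : Type) (τ₀∈A : τ₀ ∈ A)
    (realizable : ∀ α → (∀ i → Vec.lookup α i ∈ A) → Σ PVal λ v → SatI v L × Realizes α v)
    where
    open Canonical _≟ᵀ_ allTypes ∈-allTypes

    valuation : Vec Type r → PVal
    valuation α with FinP.all? (λ i → Vec.lookup α i ∈ᵀ? A)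
    ... | yes α∈A = proj₁ (realizable α α∈A)
    ... | no _    = λ _ _ → false

    valuation-spec : ∀ α → (∀ i → Vec.lookup α i ∈ A) →
                     SatI (valuation α) L × Realizes α (valuation α)
    valuation-spec α α∈A with FinP.all? (λ i → Vec.lookup α i ∈ᵀ? A)
    ... | yes α∈A′ = proj₂ (realizable α α∈A′)
    ... | no α∉A   = ⊥-elim (α∉A α∈A)

    -- The k-th type of cs goes to x_{k+1}; the remaining variables get τ₀.
    assignment : List Type → Vec Type r
    assignment cs = Vec.tabulate (nth τ₀ cs ∘ toℕ)

    slot : List Type → Type → Term
    slot cs τ = var (suc (position _≟ᵀ_ cs τ))

    valuationFor : List Type → PVal
    valuationFor = valuation ∘ assignment

    assignment∈A : ∀ {cs} → All (_∈ A) cs → ∀ i → Vec.lookup (assignment cs) i ∈ A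
    assignment∈A {cs} cs∈A i =
      ≡.subst (_∈ A) (sym (VecP.lookup∘tabulate _ i)) (nth-All cs τ₀∈A cs∈A (toℕ i))

    valuationFor-sat : ∀ {cs} → All (_∈ A) cs → SatI (valuationFor cs) L
    valuationFor-sat cs∈A = proj₁ (valuation-spec _ (assignment∈A cs∈A))

    slot-X : ∀ {cs τ} → length cs ≤ r → τ ∈ cs →
             Σ (Fin r) λ i → (slot cs τ ≡ var (xv i)) × (Vec.lookup (assignment cs) i ≡ τ)
    slot-X {cs} {τ} len τ∈ =
      i , cong (var ∘ suc) (sym toℕi) ,
      trans (VecP.lookup∘tabulate _ i) (trans (cong (nth τ₀ cs) toℕi) (nth-position _≟ᵀ_ τ₀ cs τ∈))
      where
      i : Fin r
      i = fromℕ< (≤-trans (position<length _≟ᵀ_ cs τ∈) len)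
      toℕi : toℕ i ≡ position _≟ᵀ_ cs τ
      toℕi = FinP.toℕ-fromℕ< _

    slot-type : ∀ {cs τ} → All (_∈ A) cs → length cs ≤ r → τ ∈ cs →
                typeOf (valuationFor cs) (slot cs τ) ≡ τ
    slot-type {cs} cs∈A len τ∈ with slot-X len τ∈
    ... | i , slot≡ , α≡ =
      trans (cong (typeOf (valuationFor cs)) slot≡)
            (trans (proj₂ (valuation-spec _ (assignment∈A cs∈A)) i) α≡)

    interpretation : List Type → (f : Fin nf) → Vec Type (arity f) → Type
    interpretation cs f τs = typeOf (valuationFor cs) (fun f (Vec.map (slot cs) τs))

    mutual
      ty : GTerm → Type
      ty (var ())
      ty (fun f ts) = interpretation (canon (toList (tys ts))) f (tys ts)

      tys : ∀ {n} → Vec GTerm n → Vec Type n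
      tys []       = []
      tys (t ∷ ts) = ty t ∷ tys ts

    M : D.HModel Sig
    M p t = Vec.lookup (ty t) p

    length-canon≤r : ∀ f (τs : Vec Type (arity f)) → length (canon (toList τs)) ≤ r
    length-canon≤r f τs =
      ≤-trans (length-canon id) (≤-trans (≤-reflexive (VecP.length-toList τs)) (arity≤r f))

    canonical-instance : ∀ f (τs : Vec Type (arity f)) → All (_∈ A) (toList τs) →
      let cs = canon (toList τs) in
      SatI (valuationFor cs) L × Σ (Vec (Fin r) (arity f)) λ ys → fun f (Vec.map (slot cs) τs) ≡ U f ys
    canonical-instance f τs τs∈A =
      valuationFor-sat (All.tabulate (All.lookup τs∈A ∘ ∈-canon⁻ _)) ,
      map₂ (cong (fun f)) (map-factor _ (var ∘ xv) τs slot∈X)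
      where
      slot∈X : ∀ τ → τ ∈ toList τs → ∃ λ i → slot (canon (toList τs)) τ ≡ var (xv i)
      slot∈X τ τ∈ with slot-X (length-canon≤r f τs) (∈-canon⁺ τ∈)
      ... | i , slot≡ , _ = i , slot≡

    mutual
      ty∈A : ∀ t → ty t ∈ A
      ty∈A (var ())
      ty∈A (fun f ts) with canonical-instance f (tys ts) (tys∈A ts)
      ... | sat , ys , eq =
        ≡.subst (λ u → typeOf (valuationFor cs) u ∈ A) (sym eq) (typeOf-U∈ excl sat f ys)
        where cs = canon (toList (tys ts))

      tys∈A : ∀ {n} (ts : Vec GTerm n) → All (_∈ A) (toList (tys ts))
      tys∈A []       = []
      tys∈A (t ∷ ts) = ty∈A t ∷ tys∈A ts

    instance-transfer : ∀ {C v} σ ρ →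
      (∀ l → l ∈ C → ty (subst σ (term l)) ≡ typeOf v (subst ρ (term l))) →
      v ⊨ substC ρ C → Any (λ l → M (pred l) (subst σ (term l)) ≡ sign l) C
    instance-transfer {C} {v} σ ρ agree v⊨ with find (AnyP.map⁻ {xs = C} v⊨)
    ... | l , l∈ , vl≡ = lose l∈
      (trans (cong (λ τ → Vec.lookup τ (pred l)) (agree l l∈))
             (trans (lookup-typeOf v _ (pred l)) vl≡))

    tys-substs-var : ∀ (σ : ℕ → GTerm) {n} (xs : Vec ℕ n) →
                     tys (substs σ (Vec.map var xs)) ≡ Vec.map (ty ∘ σ) xs
    tys-substs-var σ []       = refl
    tys-substs-var σ (x ∷ xs) = cong (ty (σ x) ∷_) (tys-substs-var σ xs)

    -- All function literals of a complex clause have the same variables, so one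
    -- valuation, chosen from the types of σ on those variables, serves the whole instance.
    module ComplexInstance (σ : ℕ → GTerm) (C : Clause) (cx : IsComplex C) where
      cs : List Type
      cs = canon (map (ty ∘ σ) (varsC C))

      v : PVal
      v = valuationFor cs

      ρ : ℕ → Term
      ρ = slot cs ∘ ty ∘ σ

      canon-args : ∀ {n} (xs : Vec ℕ n) → toList xs ⊆ varsC C → varsC C ⊆ toList xs →
                   canon (toList (Vec.map (ty ∘ σ) xs)) ≡ cs
      canon-args xs xs⊆ ⊆xs = trans (cong canon (VecP.toList-map (ty ∘ σ) xs))
        (canon-cong (SubsetP.map⁺ (ty ∘ σ) xs⊆) (SubsetP.map⁺ (ty ∘ σ) ⊆xs))

      length-cs : length cs ≤ r
      length-cs with find (proj₁ cx)
      ... | _ , _ , g , xs , _ , cov =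
        ≡.subst (λ cs′ → length cs′ ≤ r) (uncurry (canon-args xs) (toList-⊆⊇ cov))
                (length-canon≤r g (Vec.map (ty ∘ σ) xs))

      cs∈A : All (_∈ A) cs
      cs∈A = All.tabulate λ τ∈ → ∈A (∈-map⁻ (ty ∘ σ) (∈-canon⁻ (map (ty ∘ σ) (varsC C)) τ∈))
        where
        ∈A : ∀ {τ} → ∃ (λ y → y ∈ varsC C × τ ≡ ty (σ y)) → τ ∈ A
        ∈A (y , _ , refl) = ty∈A (σ y)

      σ∈cs : ∀ {y} → y ∈ varsC C → ty (σ y) ∈ cs
      σ∈cs y∈ = ∈-canon⁺ (∈-map⁺ (ty ∘ σ) y∈)

      ρ-into-X : IntoX ρ C
      ρ-into-X y y∈ with slot-X length-cs (σ∈cs y∈)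
      ... | i , slot≡ , _ = i , slot≡

      agree-var : ∀ y → y ∈ varsC C → ty (σ y) ≡ typeOf v (ρ y)
      agree-var y y∈ = sym (slot-type cs∈A length-cs (σ∈cs y∈))

      agree-fun : ∀ g (xs : Vec ℕ (arity g)) → toList xs ⊆ varsC C → varsC C ⊆ toList xs →
        ty (subst σ (fun g (Vec.map var xs))) ≡ typeOf v (subst ρ (fun g (Vec.map var xs)))
      agree-fun g xs xs⊆ ⊆xs = begin
        interpretation (canon (toList (tys (substs σ (Vec.map var xs))))) g (tys (substs σ (Vec.map var xs)))
          ≡⟨ cong (λ τs → interpretation (canon (toList τs)) g τs) (tys-substs-var σ xs) ⟩
        interpretation (canon (toList (Vec.map (ty ∘ σ) xs))) g (Vec.map (ty ∘ σ) xs)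
          ≡⟨ cong (λ cs′ → interpretation cs′ g (Vec.map (ty ∘ σ) xs)) (canon-args xs xs⊆ ⊆xs) ⟩
        typeOf v (fun g (Vec.map (slot cs) (Vec.map (ty ∘ σ) xs)))
          ≡⟨ cong (typeOf v ∘ fun g) (VecP.map-∘ (slot cs) (ty ∘ σ) xs) ⟨
        typeOf v (fun g (Vec.map ρ xs))
          ≡⟨ cong (typeOf v ∘ fun g) (substs-map-var ρ xs) ⟨
        typeOf v (fun g (substs ρ (Vec.map var xs)))
          ∎
        where open ≡.≡-Reasoning

    complex-satisfied : ∀ {C} → C ∈ L → IsComplex C → D.HSatClause Sig M C
    complex-satisfied {C} C∈L cx σ =
      instance-transfer σ ρ agree (proj₁ (valuationFor-sat cs∈A C C∈L) cx ρ ρ-into-X)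
      where
      open ComplexInstance σ C cx
      agree : ∀ l → l ∈ C → ty (subst σ (term l)) ≡ typeOf v (subst ρ (term l))
      agree l l∈ with All.lookup (proj₂ cx) l∈
      ... | inj₁ (g , xs , t≡ , cov) rewrite t≡ = uncurry (agree-fun g xs) (toList-⊆⊇ cov)
      ... | inj₂ (y , t≡) rewrite t≡ = agree-var y (var-∈-varsC l∈ t≡)

    U-witness : (t : GTerm) → Σ PVal λ v → SatI v L ×
      Σ (Fin nf) λ f → Σ (Vec (Fin r) (arity f)) λ ys → ty t ≡ typeOf v (U f ys)
    U-witness (var ())
    U-witness (fun f ts) with canonical-instance f (tys ts) (tys∈A ts)
    ... | sat , ys , eq = _ , sat , f , ys , cong (typeOf (valuationFor (canon (toList (tys ts))))) eq

    block-satisfied : ∀ {C} → C ∈ L → IsEpsBlock C → D.HSatClause Sig M C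
    block-satisfied {[]} C∈L eb σ with proj₁ (proj₂ (valuationFor-sat {[]} [] [] C∈L) eb)
    ... | ()
    block-satisfied {l ∷ C} C∈L eb@(vl , single) σ with All.head vl
    ... | y , t≡y with U-witness (σ y)
    ...   | v , sat , f , ys , ty≡ =
      instance-transfer σ (λ _ → U f ys) agree (proj₂ (proj₂ (sat _ C∈L) eb) f ys)
      where
      agree : ∀ l′ → l′ ∈ l ∷ C → ty (subst σ (term l′)) ≡ typeOf v (subst (λ _ → U f ys) (term l′))
      agree l′ l′∈ with All.lookup vl l′∈
      ... | y′ , t′≡y′
        rewrite t′≡y′ | single y′ y (var-∈-varsC l′∈ t′≡y′) (var-∈-varsC {l ∷ C} (here refl) t≡y) = ty≡

    satisfiable : All ComplexOrBlock L → D.Satisfiable Sig L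
    satisfiable ks = M , λ C C∈ → [ complex-satisfied C∈ , block-satisfied C∈ ]′ (All.lookup ks C∈)

  ▶-++ˡ : ∀ P {X Y} → X ▶ Y → (P ++ X) ▶ (P ++ Y)
  ▶-++ˡ P (D.expand T₁ T₂ S b bs comps nonempty disjoint entailed) =
    ≡.subst₂ _▶_ (ListP.++-assoc P T₁ (S ∷ T₂)) (ListP.++-assoc P T₁ _)
      (D.expand (P ++ T₁) T₂ S b bs comps nonempty disjoint entailed)

  ▶-++ʳ : ∀ Q {X Y} → X ▶ Y → (X ++ Q) ▶ (Y ++ Q)
  ▶-++ʳ Q (D.expand T₁ T₂ S b bs comps nonempty disjoint entailed) =
    ≡.subst₂ _▶_ (sym (ListP.++-assoc T₁ (S ∷ T₂) Q)) reassoc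
      (D.expand T₁ (T₂ ++ Q) S b bs comps nonempty disjoint entailed)
    where
    Bs : Tableau
    Bs = map (λ p → proj₁ p ∷ S) (b ∷ bs)
    reassoc : T₁ ++ Bs ++ T₂ ++ Q ≡ (T₁ ++ Bs ++ T₂) ++ Q
    reassoc = trans (cong (T₁ ++_) (sym (ListP.++-assoc Bs T₂ Q)))
                    (sym (ListP.++-assoc T₁ (Bs ++ T₂) Q))

  Closable : List Clause → Set
  Closable S = Σ Tableau λ T → (S ∷ []) ▶* T × D.Closed Sig T

  close-all : ∀ Ss → All Closable Ss → Σ Tableau λ T → Ss ▶* T × D.Closed Sig T
  close-all []       []                      = [] , ε , []
  close-all (S ∷ Ss) ((T , S▶*T , closed) ∷ cls) with close-all Ss cls
  ... | T′ , Ss▶*T′ , closed′ =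
    T ++ T′ ,
    Star.gmap (_++ Ss) (▶-++ʳ Ss) S▶*T ◅◅ Star.gmap (T ++_) (▶-++ˡ T) Ss▶*T′ ,
    AllP.++⁺ closed closed′

  closable-by-□ : ∀ {L} → L ⊨ₚ [] → Closable L
  closable-by-□ {L} entailed =
    (([] ∷ L) ∷ []) ,
    D.expand [] [] L ([] , 1) [] (□-component ∷ []) [] ([] ∷ []) entailed ◅ ε ,
    here refl ∷ []
    where
    □-component : EpsComponent ([] , 1)
    □-component = ([] , λ _ _ ()) , (λ _ ()) , s≤s z≤n , s≤s z≤n

  closable-by-expansion : ∀ L bs → bs ≢ [] → All EpsComponent bs → All (λ b → proj₁ b ≢ []) bs →
    AllPairs VarDisjoint (map rename bs) → L ⊨ₚ concat (map rename bs) →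
    All (λ b → Closable (proj₁ b ∷ L)) bs → Closable L
  closable-by-expansion L []       []≢[] = ⊥-elim ([]≢[] refl)
  closable-by-expansion L (b ∷ bs) _ comps (_ ∷ nonempty) disjoint entailed branches
    with close-all (map (λ b → proj₁ b ∷ L) (b ∷ bs)) (AllP.map⁺ branches)
  ... | T , steps , closed = T , step ◅ steps , closed
    where
    step : (L ∷ []) ▶ map (λ b → proj₁ b ∷ L) (b ∷ bs)
    step = ≡.subst ((L ∷ []) ▶_) (ListP.++-identityʳ _)
                   (D.expand [] [] L b bs comps nonempty disjoint entailed)

  -- A over-approximates the types not yet excluded on the branch L; it shrinks
  -- on every branch of an expansion, which bounds the depth of the tableau.
  closable : ∀ n L → All ComplexOrBlock L → (A : List Type) → length A ≤ n →
             (∀ τ → τ ∉ A → excluded τ ∈ L) → ¬ D.Satisfiable Sig L → Closable L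
  closable n L ks A len excl unsat with decide-⊨ₚ L ks []
  ... | inj₁ entails□ = closable-by-□ entails□
  ... | inj₂ (v₀ , sat₀ , _) with Any⊎All (decide-⊨ₚ L ks ∘ concat ∘ map rename ∘ blocks) (vectors A r)
  ...   | inj₂ refuted =
    ⊥-elim (unsat (HerbrandModel.satisfiable L A excl _ (typeOf-xᵣ₊₁∈ excl sat₀) realizable ks))
    where
    realizable : ∀ α → (∀ i → Vec.lookup α i ∈ A) → Σ PVal λ v → SatI v L × Realizes α v
    realizable α α∈A with All.lookup refuted (∈-vectors⁺ α α∈A)
    ... | v , sat , v⊭ = v , sat , ⊭blocks⇒Realizes α v⊭
  ...   | inj₁ entailed with find entailed
  ...     | α , α∈ , L⊨blocks =
    closable-by-expansion L (blocks α) (⊨-concat⇒≢[] (blocks α) v₀⊨)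
      (blocks-components α) (blocks-nonempty α (pred (proj₁ (Any.satisfied v₀⊨))))
      (blocks-disjoint α) L⊨blocks (AllP.tabulate⁺ λ i → after-excluding n (∈-vectors⁻ A α∈ i) len)
    where
    -- Through v₀ the entailed ε-clause has a literal, so r > 0 and np > 0.
    v₀⊨ : v₀ ⊨ concat (map rename (blocks α))
    v₀⊨ = L⊨blocks v₀ sat₀

    after-excluding : ∀ m {τ} → τ ∈ A → length A ≤ m → Closable (excluded τ ∷ L)
    after-excluding zero    τ∈A len′ = ⊥-elim (ℕP.n≮0 (≤-trans (length-remove< _≟ᵀ_ τ∈A) len′))
    after-excluding (suc m) {τ} τ∈A len′ =
      closable m (excluded τ ∷ L) (inj₂ (excluded-block τ) ∷ ks) (remove _≟ᵀ_ τ A)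
        (ℕP.≤-pred (≤-trans (length-remove< _≟ᵀ_ τ∈A) len′)) excl′ (unsat ∘ weaken)
      where
      excl′ : ∀ τ′ → τ′ ∉ remove _≟ᵀ_ τ A → excluded τ′ ∈ excluded τ ∷ L
      excl′ τ′ τ′∉ with ∉-remove _≟ᵀ_ {x = τ} τ′∉
      ... | inj₁ refl  = here refl
      ... | inj₂ τ′∉A = there (excl τ′ τ′∉A)

      weaken : D.Satisfiable Sig (excluded τ ∷ L) → D.Satisfiable Sig L
      weaken (M , sat) = M , λ C → sat C ∘ there

  complete : ∀ S → All ComplexOrBlock S → ¬ D.Satisfiable Sig S → Closable S
  complete S ks =
    closable (length allTypes) S ks allTypes ℕP.≤-refl (λ τ τ∉ → ⊥-elim (τ∉ (∈-allTypes τ)))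

open import Defs

lemma8 : (Sig : Signature) (S : List (Clause Sig)) →
    All (λ C → IsComplex Sig C ⊎ IsEpsBlock Sig C) S →
    ¬ Satisfiable Sig S →
    Σ (Tableau Sig) (λ T → _▶*_ Sig (S ∷ []) T × Closed Sig T)
lemma8 Sig = Completeness.complete Sig
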